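{- Let $w$ be a word with $s_1(w)=s_2(w)=2$ (a 2FS square), and let $sq_1,SQ_1$ (resp. $sq_2,SQ_2$) be the roots of the two squares whose last occurrence in $w$ starts at location 1 (resp. 2), with $|sq_1|<|SQ_1|$ and $|sq_2|<|SQ_2|$. If $|SQ_1|\neq|SQ_2|$, then $|sq_1|<|sq_2|$.
   Context: A square is a word $uu$ with $u$ nonempty; $u$ is its root. A square $uu$ occurs at location $k$ of $w=a_1\cdots a_n$ if $a_k\cdots a_{k+2|u|-1}=uu$. $s_k(w)$ is the number of distinct squares occurring at location $k$ of $w$ but at no location $k'>k$. It is known that $s_k(w)\le 2$. -}

module Defs where

open import Data.Nat using (ℕ; suc; _<_)
open import Data.List using (List; []; _++_; length)
open import Data.List.Membership.Propositional using (_∈_)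
open import Data.List.Relation.Unary.Unique.Propositional using (Unique)
open import Data.Product using (Σ; ∃; _×_)
open import Relation.Binary.PropositionalEquality using (_≡_; _≢_)
open import Relation.Nullary using (¬_)
open import Function.Bundles using (_⇔_)

-- Words over an arbitrary alphabet A are lists; locations are 1-based as in
-- the paper: w = a₁ ⋯ aₙ and location k refers to position aₖ.

SquareAt : {A : Set} → List A → ℕ → List A → Set
SquareAt {A} w k u =
  (u ≢ []) × (Σ (List A) λ pre → Σ (List A) λ rest →
     (suc (length pre) ≡ k) × (w ≡ pre ++ (u ++ (u ++ rest))))

LastSquareAt : {A : Set} → List A → ℕ → List A → Set
LastSquareAt w k u = SquareAt w k u × (∀ k' → k < k' → ¬ SquareAt w k' u)

-- s_k(w) = n : there are exactly n distinct squares (identified by their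
-- roots, since uu = vv iff u = v) whose last occurrence is at location k.
sIs : {A : Set} → List A → ℕ → ℕ → Set
sIs {A} w k n = Σ (List (List A)) λ L →
  Unique L × (∀ u → (u ∈ L) ⇔ LastSquareAt w k u) × (length L ≡ n)

-- Read w as the function i ↦ w ‼ i, so that squares and their recurrences become periods
-- of w on intervals. With p, P, q, Q the lengths of sq₁, SQ₁, sq₂, SQ₂, lastness of sq₁
-- and sq₂ forces P < 2p and Q < 2q, and if q < p it forces P ≤ 2q (else sq₂ sq₂ recurs
-- inside SQ₁ SQ₁). Two squares with roots s < s + D at one position give the period D
-- next to them, squares at adjacent positions give further periods, and these are merged
-- by the Fine–Wilf theorem and by spreading a period g from a window of length d to a
-- longer interval of period d when g ∣ d. In the cases q < p and p = q (where P ≠ Q is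
-- used) this yields a period h with 0 < h ≤ P − p on [0, 2p + h), i.e. a later occurrence
-- of sq₁ sq₁.

module Submission where

open import Defs

open import Data.Empty using (⊥; ⊥-elim)
open import Data.List using (List; []; _∷_; _++_; length; take; drop)
open import Data.List.Properties using (++-assoc; length-++; length-take; take++drop≡id)
open import Data.Maybe using (Maybe; just; nothing)
open import Data.Nat
open import Data.Nat.Divisibility using (_∣_; divides; ∣-refl; ∣-trans; ∣⇒≤; ∣m∣n⇒∣m+n; ∣m+n∣m⇒∣n)
open import Data.Nat.Induction using (<-rec)
open import Data.Nat.Properties
open import Algebra.Properties.CommutativeSemigroup +-commutativeSemigroup using (xy∙z≈xz∙y; x∙yz≈xz∙y)
open import Data.Nat.Tactic.RingSolver using (solve)
open import Data.Product using (∃; _×_; _,_; proj₁; proj₂)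
open import Function.Base using (_∋_; _∘_)
open import Function.Bundles using (_⇔_; mk⇔; Equivalence)
open import Relation.Binary using (tri<; tri≈; tri>)
open import Relation.Binary.PropositionalEquality
open import Relation.Nullary using (¬_; yes; no)

m+n≤1+o⇒m≤o : ∀ m {n o} → 0 < n → m + n ≤ suc o → m ≤ o
m+n≤1+o⇒m≤o m {n} 0<n m+n≤1+o = ≤-pred (≤-trans (subst (_≤ m + n) (+-comm m 1) (+-monoʳ-≤ m 0<n)) m+n≤1+o)

≤-slack : ∀ {m n} k → m + k ≡ n → m ≤ n
≤-slack {m} k refl = m≤m+n m k

m<n⇒∃[o]0<o×m+o≡n : ∀ {m n} → m < n → ∃ λ o → 0 < o × m + o ≡ n
m<n⇒∃[o]0<o×m+o≡n {m} m<n with m≤n⇒∃[o]m+o≡n (<⇒≤ m<n)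
... | o , refl = o , +-cancelˡ-< m 0 o (subst (_< m + o) (sym (+-identityʳ m)) m<n) , refl

≤-by-summand : ∀ {m n} k {x y} → x ≤ y → m ≡ k + x → k + y ≡ n → m ≤ n
≤-by-summand k x≤y refl refl = +-monoʳ-≤ k x≤y

module Periodicity {X : Set} (f : ℕ → X) where

  HasPeriod : (d a b : ℕ) → Set
  HasPeriod d a b = ∀ i → a ≤ i → i + d < b → f i ≡ f (i + d)

  restrict : ∀ {d a b a′ b′} → HasPeriod d a b → a ≤ a′ → b′ ≤ b → HasPeriod d a′ b′
  restrict per a≤a′ b′≤b i a′≤i i+d<b′ = per i (≤-trans a≤a′ a′≤i) (<-≤-trans i+d<b′ b′≤b)

  period-multiple : ∀ {d a b} → HasPeriod d a b →
                    ∀ k i → a ≤ i → i + k * d < b → f i ≡ f (i + k * d)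
  period-multiple per zero i _ _ = cong f (sym (+-identityʳ i))
  period-multiple {d} {b = b} per (suc k) i a≤i i+[1+k]d<b = begin
      f i                 ≡⟨ per i a≤i (≤-<-trans (+-monoʳ-≤ i (m≤m+n d (k * d))) i+[1+k]d<b) ⟩
      f (i + d)           ≡⟨ period-multiple per k (i + d) (≤-trans a≤i (m≤m+n i d)) i+d+kd<b ⟩
      f (i + d + k * d)   ≡⟨ cong f (+-assoc i d (k * d)) ⟩
      f (i + (d + k * d)) ∎
    where
    open ≡-Reasoning
    i+d+kd<b : i + d + k * d < b
    i+d+kd<b = subst (_< b) (sym (+-assoc i d (k * d))) i+[1+k]d<b

  join : ∀ {g a b c e} → HasPeriod g a b → HasPeriod g c e → c + g ≤ b → b ≤ e → HasPeriod g a e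
  join {g} {b = b} {c} left right c+g≤b b≤e i a≤i i+g<e with i + g <? b
  ... | yes i+g<b = left i a≤i i+g<b
  ... | no  i+g≮b = right i (+-cancelʳ-≤ g c i (≤-trans c+g≤b (≮⇒≥ i+g≮b))) i+g<e

  shift : ∀ {s g a b} → HasPeriod s a (b + s) → HasPeriod g a b → HasPeriod g (a + s) (b + s)
  shift {s} {g} {a} {b} per-s per-g j a+s≤j j+g<b+s with m≤n⇒∃[o]m+o≡n a+s≤j
  ... | k , refl = begin
      f (a + s + k)     ≡⟨ cong f (xy∙z≈xz∙y a s k) ⟩
      f (a + k + s)     ≡⟨ per-s (a + k) (m≤m+n a k) (+-monoˡ-< s (≤-<-trans (m≤m+n (a + k) g) i+g<b)) ⟨
      f (a + k)         ≡⟨ per-g (a + k) (m≤m+n a k) i+g<b ⟩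
      f (a + k + g)     ≡⟨ per-s (a + k + g) (≤-trans (m≤m+n a k) (m≤m+n (a + k) g)) i+g+s<b+s ⟩
      f (a + k + g + s) ≡⟨ cong f (sym reorder) ⟩
      f (a + s + k + g) ∎
    where
    open ≡-Reasoning
    reorder : a + s + k + g ≡ a + k + g + s
    reorder = solve (a ∷ s ∷ k ∷ g ∷ [])
    i+g+s<b+s : a + k + g + s < b + s
    i+g+s<b+s = subst (_< b + s) reorder j+g<b+s
    i+g<b : a + k + g < b
    i+g<b = +-cancelʳ-< s (a + k + g) b i+g+s<b+s

  -- Every index is connected to the window [c, c + d) by steps of length d,
  -- along which the relation f i ≡ f (i + g) is invariant.
  module Spread {d g a b c e m : ℕ} (per-d : HasPeriod d a b) (per-g : HasPeriod g c e)
                (a≤c : a ≤ c) (c+d≤e : c + d ≤ e) (e≤b : e ≤ b) (d≡ : d ≡ g + m * g) (0<d : 0 < d) where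

    step-invariant : ∀ i → a ≤ i → i + d + g < b → (f i ≡ f (i + g)) ⇔ (f (i + d) ≡ f (i + d + g))
    step-invariant i a≤i i+d+g<b = mk⇔ (λ eq → trans (sym here) (trans eq there))
                                        (λ eq → trans here (trans eq (sym there)))
      where
      here : f i ≡ f (i + d)
      here = per-d i a≤i (≤-<-trans (m≤m+n (i + d) g) i+d+g<b)
      swap : i + d + g ≡ i + g + d
      swap = solve (i ∷ d ∷ g ∷ [])
      there : f (i + g) ≡ f (i + d + g)
      there = trans (per-d (i + g) (≤-trans a≤i (m≤m+n i g)) (subst (_< b) swap i+d+g<b))
                    (cong f (sym swap))

    window : ∀ j → c ≤ j → j < c + d → j + g < b → f j ≡ f (j + g)
    window j c≤j j<c+d j+g<b with j + g <? e
    ... | yes j+g<e = per-g j c≤j j+g<e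
    ... | no  j+g≮e with m≤n⇒∃[o]m+o≡n (≤-trans c+d≤e (≮⇒≥ j+g≮e))
    ...   | k , c+d+k≡j+g = begin
        f j                 ≡⟨ cong f j′+mg≡j ⟨
        f (c + k + m * g)   ≡⟨ period-multiple per-g m (c + k) (m≤m+n c k)
                                 (subst (_< e) (sym j′+mg≡j) (<-≤-trans j<c+d c+d≤e)) ⟨
        f (c + k)           ≡⟨ per-d (c + k) (≤-trans a≤c (m≤m+n c k)) (subst (_< b) (sym j′+d≡j+g) j+g<b) ⟩
        f (c + k + d)       ≡⟨ cong f j′+d≡j+g ⟩
        f (j + g)           ∎
      where
      open ≡-Reasoning
      j′+d≡j+g : c + k + d ≡ j + g
      j′+d≡j+g = trans (xy∙z≈xz∙y c k d) c+d+k≡j+g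
      j′+mg+g≡j′+d : c + k + m * g + g ≡ c + k + d
      j′+mg+g≡j′+d = trans (+-assoc (c + k) (m * g) g)
                       (cong (c + k +_) (trans (+-comm (m * g) g) (sym d≡)))
      j′+mg≡j : c + k + m * g ≡ j
      j′+mg≡j = +-cancelʳ-≡ g (c + k + m * g) j (trans j′+mg+g≡j′+d j′+d≡j+g)

    above : ∀ n j → c ≤ j → j < c + n * d → j + g < b → f j ≡ f (j + g)
    above zero j c≤j j<c+0 _ = ⊥-elim (<⇒≱ j<c+0 (subst (_≤ j) (sym (+-identityʳ c)) c≤j))
    above (suc n) j c≤j j<c+[1+n]d j+g<b with j <? c + d
    ... | yes j<c+d = window j c≤j j<c+d j+g<b
    ... | no  j≮c+d with m≤n⇒∃[o]m+o≡n (≮⇒≥ j≮c+d)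
    ...   | k , refl = subst (λ x → f x ≡ f (x + g)) (xy∙z≈xz∙y c k d)
                         (Equivalence.to (step-invariant (c + k) (≤-trans a≤c (m≤m+n c k)) j′+d+g<b)
                           (above n (c + k) (m≤m+n c k) j′<c+nd j′+g<b))
      where
      swap : c + d + k + g ≡ c + k + d + g
      swap = solve (c ∷ k ∷ d ∷ g ∷ [])
      j′+d+g<b : c + k + d + g < b
      j′+d+g<b = subst (_< b) swap j+g<b
      j′+g<b : c + k + g < b
      j′+g<b = ≤-<-trans (+-monoˡ-≤ g (m≤m+n (c + k) d)) j′+d+g<b
      bound-reorder : c + (d + n * d) ≡ c + n * d + d
      bound-reorder = solve (c ∷ n ∷ d ∷ [])
      j′<c+nd : c + k < c + n * d
      j′<c+nd = +-cancelʳ-< d (c + k) (c + n * d)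
                  (subst₂ _<_ (xy∙z≈xz∙y c d k) bound-reorder j<c+[1+n]d)

    below : ∀ n i → c ≤ i + n * d → a ≤ i → i + g < b → f i ≡ f (i + g)
    below n i _ _ i+g<b with c ≤? i
    ... | yes c≤i = above (suc i) i c≤i i<c+[1+i]d i+g<b
      where
      i<c+[1+i]d : i < c + suc i * d
      i<c+[1+i]d = ≤-trans (m≤m*n (suc i) d {{>-nonZero 0<d}}) (m≤n+m (suc i * d) c)
    below zero i c≤i+0 _ _ | no c≰i = ⊥-elim (c≰i (subst (c ≤_) (+-identityʳ i) c≤i+0))
    below (suc n) i c≤i+[1+n]d a≤i i+g<b | no c≰i with i + d + g <? b
    ... | yes i+d+g<b = Equivalence.from (step-invariant i a≤i i+d+g<b)
                          (below n (i + d) (subst (c ≤_) (sym (+-assoc i d (n * d))) c≤i+[1+n]d)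
                                 (≤-trans a≤i (m≤m+n i d)) i+d+g<b)
    ... | no  i+d+g≮b = begin
        f i               ≡⟨ per-d i a≤i (<-≤-trans i+d<e e≤b) ⟩
        f (i + d)         ≡⟨ cong f i+g+mg≡i+d ⟨
        f (i + g + m * g) ≡⟨ period-multiple per-g m (i + g) c≤i+g (subst (_< e) (sym i+g+mg≡i+d) i+d<e) ⟨
        f (i + g)         ∎
      where
      open ≡-Reasoning
      i+d<e : i + d < e
      i+d<e = <-≤-trans (+-monoˡ-< d (≰⇒> c≰i)) c+d≤e
      i+g+mg≡i+d : i + g + m * g ≡ i + d
      i+g+mg≡i+d = trans (+-assoc i g (m * g)) (cong (i +_) (sym d≡))
      c≤i+g : c ≤ i + g
      c≤i+g = +-cancelʳ-≤ d c (i + g)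
                (≤-trans c+d≤e (≤-trans e≤b (subst (b ≤_) (xy∙z≈xz∙y i d g) (≮⇒≥ i+d+g≮b))))

  spread : ∀ {d g a b c e} → HasPeriod d a b → HasPeriod g c e →
           a ≤ c → c + d ≤ e → e ≤ b → g ∣ d → 0 < d → HasPeriod g a b
  spread _ _ _ _ _ (divides zero d≡0) 0<d = ⊥-elim (<⇒≢ 0<d (sym d≡0))
  spread {d} {c = c} per-d per-g a≤c c+d≤e e≤b (divides (suc m) d≡) 0<d i =
    Spread.below {m = m} per-d per-g a≤c c+d≤e e≤b d≡ 0<d c i
      (≤-trans (m≤m*n c d {{>-nonZero 0<d}}) (m≤n+m (c * d) i))

  record CommonPeriod (p q a b : ℕ) : Set where
    constructor commonPeriod
    field
      period   : ℕ
      positive : 0 < period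
      period∣p : period ∣ p
      period∣q : period ∣ q
      periodic : HasPeriod period a b

  FineWilf : (p q : ℕ) → Set
  FineWilf p q = ∀ {a b} → HasPeriod p a b → HasPeriod q a b → a + p + q ≤ suc b → CommonPeriod p q a b

  fine-wilf-sym : ∀ {p q} → FineWilf p q → FineWilf q p
  fine-wilf-sym {p} {q} fw {a} {b} per-q per-p bound
    with fw per-p per-q (subst (_≤ suc b) (xy∙z≈xz∙y a q p) bound)
  ... | commonPeriod g 0<g g∣p g∣q per-g = commonPeriod g 0<g g∣q g∣p per-g

  period-difference : ∀ {p t a b} → p ≤ b → HasPeriod p a b → HasPeriod (p + t) a b → HasPeriod t a (b ∸ p)
  period-difference {p} {t} {b = b} p≤b per-p per-p+t i a≤i i+t<b∸p = begin
      f i             ≡⟨ per-p+t i a≤i (subst (_< b) (sym reorder) i+t+p<b) ⟩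
      f (i + (p + t)) ≡⟨ cong f reorder ⟩
      f (i + t + p)   ≡⟨ per-p (i + t) (≤-trans a≤i (m≤m+n i t)) i+t+p<b ⟨
      f (i + t)       ∎
    where
    open ≡-Reasoning
    reorder : i + (p + t) ≡ i + t + p
    reorder = x∙yz≈xz∙y i p t
    i+t+p<b : i + t + p < b
    i+t+p<b = m≤o∸n⇒m+n≤o (suc (i + t)) p≤b i+t<b∸p

  -- The subtractive Euclidean step: periods p and p + t on [a, b) give period t on [a, b - p).
  fine-wilf-+ : ∀ {p t} → 0 < p → 0 < t → FineWilf p t → FineWilf p (p + t)
  fine-wilf-+ {p} {t} 0<p 0<t fine-wilf-p-t {a} {b} per-p per-p+t bound =
    commonPeriod g 0<g g∣p (∣m∣n⇒∣m+n g∣p g∣t)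
      (spread per-p per-g ≤-refl (m+n≤o⇒m≤o∸n (a + p) a+p+p≤b) (m∸n≤m b p) g∣p 0<p)
    where
    a+p+p≤b : a + p + p ≤ b
    a+p+p≤b = m+n≤1+o⇒m≤o (a + p + p) 0<t (subst (_≤ suc b) (sym (+-assoc (a + p) p t)) bound)
    p≤b : p ≤ b
    p≤b = m+n≤o⇒n≤o (a + p) a+p+p≤b
    shorter-bound : a + p + t ≤ suc (b ∸ p)
    shorter-bound = subst (a + p + t ≤_) (+-∸-assoc 1 p≤b)
                      (m+n≤o⇒m≤o∸n (a + p + t) (subst (_≤ suc b) (x∙yz≈xz∙y (a + p) p t) bound))
    open CommonPeriod (fine-wilf-p-t (restrict per-p ≤-refl (m∸n≤m b p))
                                     (period-difference p≤b per-p per-p+t) shorter-bound)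
      renaming (period to g; positive to 0<g; period∣p to g∣p; period∣q to g∣t; periodic to per-g)

  fine-wilf : ∀ {p q} → 0 < p → 0 < q → FineWilf p q
  fine-wilf {p} {q} = <-rec Goal step (p + q) refl
    where
    Goal : ℕ → Set
    Goal n = ∀ {p q} → p + q ≡ n → 0 < p → 0 < q → FineWilf p q
    euclid : ∀ {p q} → (∀ {m} → m < p + q → Goal m) → p < q → 0 < p → FineWilf p q
    euclid {p} rec p<q 0<p with m<n⇒∃[o]0<o×m+o≡n p<q
    ... | t , 0<t , refl = fine-wilf-+ 0<p 0<t (rec (+-monoʳ-< p (m<n+m t 0<p)) refl 0<p 0<t)
    step : ∀ n → (∀ {m} → m < n → Goal m) → Goal n
    step _ rec {p} {q} refl 0<p 0<q with <-cmp p q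
    ... | tri< p<q _ _ = euclid rec p<q 0<p
    ... | tri≈ _ refl _ = λ per-p _ _ → commonPeriod p 0<p ∣-refl ∣-refl per-p
    ... | tri> _ _ q<p = fine-wilf-sym (euclid (λ {m} lt → rec (subst (m <_) (+-comm q p) lt)) q<p 0<q)

  Square : (s a : ℕ) → Set
  Square s a = HasPeriod s a (a + s + s)

  nested-squares⇒period-on-root : ∀ {s D a} → Square s a → Square (s + D) a → HasPeriod D a (a + s)
  nested-squares⇒period-on-root {s} {D} {a} sq SQ i a≤i i+D<a+s = begin
      f i             ≡⟨ SQ i a≤i (subst (_< a + (s + D) + (s + D)) (sym reorder)
                                      (<-≤-trans i+D+s<a+s+s longer)) ⟩
      f (i + (s + D)) ≡⟨ cong f reorder ⟩
      f (i + D + s)   ≡⟨ sq (i + D) (≤-trans a≤i (m≤m+n i D)) i+D+s<a+s+s ⟨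
      f (i + D)       ∎
    where
    open ≡-Reasoning
    reorder : i + (s + D) ≡ i + D + s
    reorder = x∙yz≈xz∙y i s D
    i+D+s<a+s+s : i + D + s < a + s + s
    i+D+s<a+s+s = +-monoˡ-< s i+D<a+s
    longer : a + s + s ≤ a + (s + D) + (s + D)
    longer = +-mono-≤ (+-monoʳ-≤ a (m≤m+n s D)) (m≤m+n s D)

  nested-squares⇒period-past-root : ∀ {s D a} → Square s a → Square (s + D) a →
                                    HasPeriod D (a + s) (a + (s + D) + s)
  nested-squares⇒period-past-root {s} {D} {a} sq SQ j a+s≤j j+D<… with m≤n⇒∃[o]m+o≡n a+s≤j
  ... | k , refl = begin
      f (a + s + k)       ≡⟨ cong f (xy∙z≈xz∙y a s k) ⟩
      f (a + k + s)       ≡⟨ sq (a + k) (m≤m+n a k) (+-monoˡ-< s (+-monoʳ-< a k<s)) ⟨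
      f (a + k)           ≡⟨ SQ (a + k) (m≤m+n a k)
                                (+-monoˡ-< (s + D) (+-monoʳ-< a (<-≤-trans k<s (m≤m+n s D)))) ⟩
      f (a + k + (s + D)) ≡⟨ cong f reorder ⟩
      f (a + s + k + D)   ∎
    where
    open ≡-Reasoning
    reorder : a + k + (s + D) ≡ a + s + k + D
    reorder = solve (a ∷ k ∷ s ∷ D ∷ [])
    lhs : a + s + k + D ≡ a + s + D + k
    lhs = xy∙z≈xz∙y (a + s) k D
    rhs : a + (s + D) + s ≡ a + s + D + s
    rhs = cong (_+ s) (sym (+-assoc a s D))
    k<s : k < s
    k<s = +-cancelˡ-< (a + s + D) k s (subst₂ _<_ lhs rhs j+D<…)

  shifted-squares⇒period : ∀ {t e a} → 0 < e → Square (t + e) a → Square t (suc a) →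
                           HasPeriod e (suc a) (suc a + t)
  shifted-squares⇒period {t} {e} {a} 0<e SQ sq i 1+a≤i i+e<1+a+t = begin
      f i             ≡⟨ SQ i (≤-trans (n≤1+n a) 1+a≤i) (subst (_< a + (t + e) + (t + e)) (sym reorder)
                                                          (<-≤-trans i+e+t<… longer)) ⟩
      f (i + (t + e)) ≡⟨ cong f reorder ⟩
      f (i + e + t)   ≡⟨ sq (i + e) (≤-trans 1+a≤i (m≤m+n i e)) i+e+t<… ⟨
      f (i + e)       ∎
    where
    open ≡-Reasoning
    reorder : i + (t + e) ≡ i + e + t
    reorder = x∙yz≈xz∙y i t e
    i+e+t<… : i + e + t < suc a + t + t
    i+e+t<… = +-monoˡ-< t i+e<1+a+t
    longer : suc a + t + t ≤ a + (t + e) + (t + e)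
    longer = ≤-by-summand (a + t + t) (≤-trans 0<e (m≤m+n e e))
               (solve (a ∷ t ∷ []) ) (solve (a ∷ t ∷ e ∷ []))

module FrontSquares {X : Set} (f : ℕ → X) where

  open Periodicity f

  -- A period h on [a, a + s + s + h) means the square of root length s at
  -- position a occurs again at position a + h.
  NoRecurrence : (s a n : ℕ) → Set
  NoRecurrence s a n = ∀ h → 0 < h → a + s + s + h ≤ n → ¬ HasPeriod h a (a + s + s + h)

  record RecursWithin (s d : ℕ) : Set where
    constructor recursAt
    field
      distance   : ℕ
      positive   : 0 < distance
      distance≤d : distance ≤ d
      recurs     : HasPeriod distance 0 (s + s + distance)

  root-bound : ∀ {s S a n} → NoRecurrence s a n → Square S a → a + S + S ≤ n → 0 < S → S < s + s
  root-bound {s} {S} {a} last SQ fits 0<S = ≰⇒> λ s+s≤S →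
    let recurrence-fits = +-monoˡ-≤ S (subst (_≤ a + S) (sym (+-assoc a s s)) (+-monoʳ-≤ a s+s≤S))
    in last S 0<S (≤-trans recurrence-fits fits) (restrict SQ ≤-refl recurrence-fits)

  recurrence-contradiction : ∀ {p d n} → NoRecurrence p 0 n → (p + d) + (p + d) ≤ n → RecursWithin p d → ⊥
  recurrence-contradiction {p} {d} last fits (recursAt h 0<h h≤d recurs) =
    last h 0<h (≤-trans within fits) recurs
    where
    within : p + p + h ≤ (p + d) + (p + d)
    within = ≤-by-summand (p + p) (≤-trans h≤d (m≤m+n d d)) refl (solve (p ∷ d ∷ []))

  module Case-q<p {e d r : ℕ} (0<e : 0 < e) (0<d : 0 < d) (sq₁ : Square (e + d + r + e) 0)
               (SQ₁ : Square (e + d + r + e + d) 0) (sq₂ : Square (e + d + r) 1) where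

    q p : ℕ
    q = e + d + r
    p = q + e

    e≤q : e ≤ q
    e≤q = ≤-trans (m≤m+n e d) (m≤m+n (e + d) r)
    d≤q : d ≤ q
    d≤q = ≤-trans (m≤n+m d e) (m≤m+n (e + d) r)
    0<q : 0 < q
    0<q = ≤-trans 0<e e≤q
    1+q≤p : 1 + q ≤ p
    1+q≤p = ≤-by-summand q 0<e (+-comm 1 q) refl
    p≤1+q+q : p ≤ 1 + q + q
    p≤1+q+q = ≤-by-summand q (≤-trans e≤q (n≤1+n q)) refl (+-suc q q)
    1+q+q≤p+d+p : 1 + q + q ≤ p + d + p
    1+q+q≤p+d+p = ≤-by-summand (q + q) (≤-trans 0<e (m≤m+n e (e + d))) (+-comm 1 (q + q)) reorder
      where
      reorder : q + q + (e + (e + d)) ≡ p + d + p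
      reorder = e + d + r + (e + d + r) + (e + (e + d)) ≡ e + d + r + e + d + (e + d + r + e)
                ∋ solve (e ∷ d ∷ r ∷ [])

    per-d-on-root : HasPeriod d 0 p
    per-d-on-root = nested-squares⇒period-on-root sq₁ SQ₁

    per-d-at-1 : HasPeriod d 1 (1 + q)
    per-d-at-1 = restrict per-d-on-root z≤n 1+q≤p

    left-period : CommonPeriod d q 0 (1 + q + q)
    left-period = commonPeriod h 0<h (∣-trans h∣g g∣d) h∣q (join per-h-on-root per-h-sq₂ 1+h≤p p≤1+q+q)
      where
      per-e : HasPeriod e 1 (1 + q)
      per-e = shifted-squares⇒period 0<e sq₁ sq₂
      open CommonPeriod (fine-wilf 0<d 0<e per-d-at-1 per-e
                          (≤-slack (suc r) (1 + d + e + suc r ≡ suc (1 + (e + d + r))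
                                            ∋ solve (e ∷ d ∷ r ∷ []))))
        renaming (period to g; positive to 0<g; period∣p to g∣d; period∣q to g∣e; periodic to per-g)
      g≤e : g ≤ e
      g≤e = ∣⇒≤ {{>-nonZero 0<e}} g∣e
      per-g-on-root : HasPeriod g 0 p
      per-g-on-root = spread per-d-on-root per-g z≤n (s≤s d≤q) 1+q≤p g∣d 0<d
      open CommonPeriod (fine-wilf 0<q 0<g (restrict sq₂ ≤-refl p≤1+q+q) (restrict per-g-on-root z≤n ≤-refl)
                                   (+-monoʳ-≤ (1 + q) g≤e))
        renaming (period to h; positive to 0<h; period∣p to h∣q; period∣q to h∣g; periodic to per-h)
      1+g≤p : 1 + g ≤ p
      1+g≤p = ≤-trans (s≤s (≤-trans g≤e e≤q)) 1+q≤p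
      1+h≤p : 1 + h ≤ p
      1+h≤p = ≤-trans (s≤s (∣⇒≤ {{>-nonZero 0<g}} h∣g)) 1+g≤p
      per-h-on-root : HasPeriod h 0 p
      per-h-on-root = spread per-g-on-root per-h z≤n 1+g≤p ≤-refl h∣g 0<g
      per-h-sq₂ : HasPeriod h 1 (1 + q + q)
      per-h-sq₂ = spread sq₂ per-h ≤-refl 1+q≤p p≤1+q+q h∣q 0<q

    recurrence : RecursWithin p d
    recurrence = recursAt h 0<h h≤d
                   (restrict per-h-full z≤n
                      (subst (p + p + h ≤_) (xy∙z≈xz∙y p p d) (+-monoʳ-≤ (p + p) h≤d)))
      where
      open CommonPeriod left-period
        renaming (period to h; positive to 0<h; period∣p to h∣d; period∣q to h∣q; periodic to per-h)
      h≤d : h ≤ d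
      h≤d = ∣⇒≤ {{>-nonZero 0<d}} h∣d
      per-d-past-root : HasPeriod d p (p + d + p)
      per-d-past-root = nested-squares⇒period-past-root sq₁ SQ₁
      per-d-right : HasPeriod d (1 + q) (p + d + p)
      per-d-right = join (shift sq₂ per-d-at-1) per-d-past-root
                      (≤-slack (suc r) (e + d + r + e + d + suc r ≡ 1 + (e + d + r) + (e + d + r)
                                        ∋ solve (e ∷ d ∷ r ∷ [])))
                      1+q+q≤p+d+p
      per-h-right : HasPeriod h (1 + q) (p + d + p)
      per-h-right = spread per-d-right (shift sq₂ (restrict per-h z≤n (m≤m+n (1 + q) q))) ≤-refl
                      (+-monoʳ-≤ (1 + q) d≤q) 1+q+q≤p+d+p h∣d 0<d
      per-h-full : HasPeriod h 0 (p + d + p)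
      per-h-full = join per-h per-h-right (+-monoʳ-≤ (1 + q) (∣⇒≤ {{>-nonZero 0<q}} h∣q)) 1+q+q≤p+d+p

  period-extends-to-origin : ∀ {p m g B} → 0 < p → 0 < g → g ≤ p → g ∣ m →
    Square p 0 → Square p 1 → HasPeriod (p + m) p (p + (p + m) + g) → HasPeriod g p B →
    p + (p + m) + g ≤ B → 1 + p + p ≤ B → CommonPeriod p g 0 B
  period-extends-to-origin {p} {m} {g} {B} 0<p 0<g g≤p g∣m sq₀ sq₁ per-p+m per-g long-enough 1+p+p≤B =
    commonPeriod h 0<h h∣p h∣g (join per-h-left per-h-right p+h≤1+p+p 1+p+p≤B)
    where
    open CommonPeriod (fine-wilf (≤-trans 0<p (m≤m+n p m)) 0<g per-p+m (restrict per-g ≤-refl long-enough)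
                                 (n≤1+n _))
      renaming (period to h; positive to 0<h; period∣p to h∣p+m; period∣q to h∣g; periodic to per-h)
    h∣p : h ∣ p
    h∣p = ∣m+n∣m⇒∣n (subst (h ∣_) (+-comm p m) h∣p+m) (∣-trans h∣g g∣m)
    p+h≤1+p+p : p + h ≤ 1 + p + p
    p+h≤1+p+p = ≤-trans (+-monoʳ-≤ p (≤-trans (∣⇒≤ {{>-nonZero 0<g}} h∣g) g≤p)) (n≤1+n (p + p))
    per-h-right : HasPeriod h p B
    per-h-right = spread per-g per-h ≤-refl (+-monoˡ-≤ g (m≤m+n p (p + m))) long-enough h∣g 0<g
    per-h-left : HasPeriod h 0 (1 + p + p)
    per-h-left = spread (join sq₀ sq₁ (≤-by-summand p 0<p (+-comm 1 p) refl) (n≤1+n (p + p)))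
                   (restrict per-h-right ≤-refl 1+p+p≤B) z≤n (n≤1+n (p + p)) ≤-refl h∣p 0<p

  case-p≡q∧P<Q : ∀ {p d t} → 0 < p → 0 < d → 0 < t → d + t < p →
             Square p 0 → Square p 1 → Square (p + d) 0 → Square (p + d + t) 1 → RecursWithin p d
  case-p≡q∧P<Q {p} {d} {t} 0<p 0<d 0<t d+t<p sq₁ sq₂ SQ₁ SQ₂ =
    recursAt h 0<h (≤-trans h≤g g≤d) (restrict per-h z≤n p+p+h≤1+Q+p)
    where
    p+d+p≤1+Q+p : p + d + p ≤ (1 + (p + (d + t)) + p)
    p+d+p≤1+Q+p = ≤-slack (suc t) (solve (p ∷ d ∷ t ∷ []))
    1+p+d≤p+d+p : 1 + p + d ≤ p + d + p
    1+p+d≤p+d+p = ≤-by-summand (p + d) 0<p (solve (p ∷ d ∷ [])) refl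
    per-d : HasPeriod d p (p + d + p)
    per-d = nested-squares⇒period-past-root sq₁ SQ₁
    per-d+t : HasPeriod (d + t) (1 + p) (1 + (p + (d + t)) + p)
    per-d+t = nested-squares⇒period-past-root sq₂ (subst (λ x → Square x 1) (+-assoc p d t) SQ₂)
    open CommonPeriod (fine-wilf 0<d (≤-trans 0<d (m≤m+n d t)) (restrict per-d (n≤1+n p) ≤-refl)
                                 (restrict per-d+t ≤-refl p+d+p≤1+Q+p)
                                 (s≤s (+-monoʳ-≤ (p + d) (<⇒≤ d+t<p))))
      renaming (period to g; positive to 0<g; period∣p to g∣d; period∣q to g∣d+t; periodic to per-g)
    g≤d : g ≤ d
    g≤d = ∣⇒≤ {{>-nonZero 0<d}} g∣d
    g≤t : g ≤ t
    g≤t = ∣⇒≤ {{>-nonZero 0<t}} (∣m+n∣m⇒∣n g∣d+t g∣d)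
    per-g-left : HasPeriod g p (p + d + p)
    per-g-left = spread per-d per-g (n≤1+n p) 1+p+d≤p+d+p ≤-refl g∣d 0<d
    per-g-right : HasPeriod g (1 + p) (1 + (p + (d + t)) + p)
    per-g-right = spread per-d+t per-g ≤-refl
                    (≤-by-summand p (≤-trans d+t<p (m≤n+m p d)) (solve (p ∷ d ∷ t ∷ []))
                                  (sym (+-assoc p d p)))
                    p+d+p≤1+Q+p g∣d+t (≤-trans 0<d (m≤m+n d t))
    open CommonPeriod (period-extends-to-origin 0<p 0<g (≤-trans g≤d (≤-trans (m≤m+n d t) (<⇒≤ d+t<p)))
                         g∣d sq₁ sq₂
                         (restrict SQ₁ z≤n (≤-by-summand (p + (p + d)) g≤d refl (solve (p ∷ d ∷ []))))
                         (join per-g-left per-g-right (≤-trans (+-monoʳ-≤ (1 + p) g≤d) 1+p+d≤p+d+p)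
                               p+d+p≤1+Q+p)
                         (≤-by-summand (p + (p + d)) (≤-trans g≤t (n≤1+n t)) refl (solve (p ∷ d ∷ t ∷ [])))
                         (≤-slack (d + t) (solve (p ∷ d ∷ t ∷ []))))
      renaming (period to h; positive to 0<h; period∣q to h∣g; periodic to per-h)
    h≤g : h ≤ g
    h≤g = ∣⇒≤ {{>-nonZero 0<g}} h∣g
    p+p+h≤1+Q+p : p + p + h ≤ (1 + (p + (d + t)) + p)
    p+p+h≤1+Q+p = ≤-by-summand (p + p) (≤-trans h≤g (≤-trans g≤d (≤-trans (m≤m+n d t) (n≤1+n (d + t)))))
                    refl (solve (p ∷ d ∷ t ∷ []))

  case-p≡q∧Q<P : ∀ {p d t} → 0 < p → 0 < d → 0 < t → d + t < p →
             Square p 0 → Square p 1 → Square (p + d + t) 0 → Square (p + d) 1 → RecursWithin p (d + t)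
  case-p≡q∧Q<P {p} {d} {t} 0<p 0<d 0<t d+t<p sq₁ sq₂ SQ₁ SQ₂ =
    recursAt h 0<h (≤-trans h≤g (≤-trans g≤d (m≤m+n d t))) (restrict per-h z≤n p+p+h≤P+p)
    where
    0<d+t : 0 < d + t
    0<d+t = ≤-trans 0<d (m≤m+n d t)
    d+t≤p : d + t ≤ p
    d+t≤p = <⇒≤ d+t<p
    1+Q+p≤P+p : 1 + (p + d) + p ≤ p + (d + t) + p
    1+Q+p≤P+p = ≤-by-summand (p + d + p) 0<t (solve (p ∷ d ∷ [])) (solve (p ∷ d ∷ t ∷ []))
    per-d+t : HasPeriod (d + t) p (p + (d + t) + p)
    per-d+t = nested-squares⇒period-past-root sq₁ (subst (λ x → Square x 0) (+-assoc p d t) SQ₁)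
    per-d : HasPeriod d (1 + p) (1 + (p + d) + p)
    per-d = nested-squares⇒period-past-root sq₂ SQ₂
    open CommonPeriod (fine-wilf 0<d 0<d+t per-d (restrict per-d+t (n≤1+n p) 1+Q+p≤P+p)
                                 (s≤s (≤-trans (+-monoʳ-≤ (p + d) d+t≤p) (n≤1+n (p + d + p)))))
      renaming (period to g; positive to 0<g; period∣p to g∣d; period∣q to g∣d+t; periodic to per-g)
    g≤d : g ≤ d
    g≤d = ∣⇒≤ {{>-nonZero 0<d}} g∣d
    g≤t : g ≤ t
    g≤t = ∣⇒≤ {{>-nonZero 0<t}} (∣m+n∣m⇒∣n g∣d+t g∣d)
    per-g-wide : HasPeriod g p (p + (d + t) + p)
    per-g-wide = spread per-d+t per-g (n≤1+n p)
                   (s≤s (≤-by-summand (p + d) (≤-trans (m≤n+m t d) d+t≤p) (sym (+-assoc p d t)) refl))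
                   1+Q+p≤P+p g∣d+t 0<d+t
    open CommonPeriod (period-extends-to-origin 0<p 0<g (≤-trans g≤d (≤-trans (m≤m+n d t) d+t≤p))
                         g∣d sq₁ sq₂
                         (restrict SQ₂ 0<p (≤-by-summand (p + (p + d)) (≤-trans g≤d (n≤1+n d)) refl
                                                         (solve (p ∷ d ∷ []))))
                         per-g-wide
                         (≤-by-summand (p + (p + d)) g≤t refl (solve (p ∷ d ∷ t ∷ [])))
                         (≤-by-summand (p + p) 0<d+t (solve (p ∷ [])) (solve (p ∷ d ∷ t ∷ []))))
      renaming (period to h; positive to 0<h; period∣q to h∣g; periodic to per-h)
    h≤g : h ≤ g
    h≤g = ∣⇒≤ {{>-nonZero 0<g}} h∣g
    p+p+h≤P+p : p + p + h ≤ p + (d + t) + p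
    p+p+h≤P+p = ≤-by-summand (p + p) (≤-trans h≤g (≤-trans g≤d (m≤m+n d t))) refl (solve (p ∷ d ∷ t ∷ []))

  not-q<p : ∀ {n p P q} → Square p 0 → Square P 0 → P + P ≤ n → Square q 1 →
            p < P → q < p → NoRecurrence p 0 n → NoRecurrence q 1 n → ⊥
  not-q<p {P = P} {q} sq₁ SQ₁ SQ₁-fits sq₂ p<P q<p last₁ last₂ with 1 + q + q ≤? P
  ... | yes 1+q+q≤P = last₂ P (≤-trans (s≤s z≤n) p<P) (≤-trans recurrence-fits SQ₁-fits)
                        (restrict SQ₁ z≤n recurrence-fits)
    where
    recurrence-fits : 1 + q + q + P ≤ P + P
    recurrence-fits = +-monoˡ-≤ P 1+q+q≤P
  ... | no 1+q+q≰P with m<n⇒∃[o]0<o×m+o≡n q<p | m<n⇒∃[o]0<o×m+o≡n p<P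
  ...   | e , 0<e , refl | d , 0<d , refl
        with m≤n⇒∃[o]m+o≡n (+-cancelˡ-≤ q (e + d) q
                              (subst (_≤ q + q) (+-assoc q e d) (≤-pred (≰⇒> 1+q+q≰P))))
  ...     | r , refl = recurrence-contradiction last₁ SQ₁-fits (Case-q<p.recurrence 0<e 0<d sq₁ SQ₁ sq₂)

  not-p≡q : ∀ {n p P Q} → Square p 0 → Square P 0 → P + P ≤ n → Square p 1 → Square Q 1 → 1 + Q + Q ≤ n →
            0 < p → p < P → p < Q → P ≢ Q → NoRecurrence p 0 n → NoRecurrence p 1 n → ⊥
  not-p≡q {p = p} {P} {Q} sq₁ SQ₁ SQ₁-fits sq₂ SQ₂ SQ₂-fits 0<p p<P p<Q P≢Q last₁ last₂ with <-cmp P Q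
  ... | tri≈ _ P≡Q _ = P≢Q P≡Q
  ... | tri< P<Q _ _ with m<n⇒∃[o]0<o×m+o≡n p<P | m<n⇒∃[o]0<o×m+o≡n P<Q
  ...   | d , 0<d , refl | t , 0<t , refl =
    recurrence-contradiction last₁ SQ₁-fits (case-p≡q∧P<Q 0<p 0<d 0<t d+t<p sq₁ sq₂ SQ₁ SQ₂)
    where
    Q<p+p : p + d + t < p + p
    Q<p+p = root-bound {s = p} last₂ SQ₂ SQ₂-fits (≤-trans 0<p (≤-trans (m≤m+n p d) (m≤m+n (p + d) t)))
    d+t<p : d + t < p
    d+t<p = +-cancelˡ-< p (d + t) p (subst (_< p + p) (+-assoc p d t) Q<p+p)
  not-p≡q {n} {p} sq₁ SQ₁ SQ₁-fits sq₂ SQ₂ SQ₂-fits 0<p p<P p<Q P≢Q last₁ last₂ | tri> _ _ Q<P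
    with m<n⇒∃[o]0<o×m+o≡n p<Q | m<n⇒∃[o]0<o×m+o≡n Q<P
  ...   | d , 0<d , refl | t , 0<t , refl =
    recurrence-contradiction last₁ (subst (λ P → P + P ≤ n) (+-assoc p d t) SQ₁-fits)
      (case-p≡q∧Q<P 0<p 0<d 0<t d+t<p sq₁ sq₂ SQ₁ SQ₂)
    where
    P<p+p : p + d + t < p + p
    P<p+p = root-bound {s = p} last₁ SQ₁ SQ₁-fits (≤-trans 0<p (≤-trans (m≤m+n p d) (m≤m+n (p + d) t)))
    d+t<p : d + t < p
    d+t<p = +-cancelˡ-< p (d + t) p (subst (_< p + p) (+-assoc p d t) P<p+p)

  two-front-squares : ∀ {n p P q Q} →
    Square p 0 → Square P 0 → P + P ≤ n → Square q 1 → Square Q 1 → 1 + Q + Q ≤ n →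
    0 < p → p < P → q < Q → P ≢ Q → NoRecurrence p 0 n → NoRecurrence q 1 n → p < q
  two-front-squares {p = p} {q = q} sq₁ SQ₁ SQ₁-fits sq₂ SQ₂ SQ₂-fits 0<p p<P q<Q P≢Q last₁ last₂
    with <-cmp p q
  ... | tri< p<q _ _ = p<q
  ... | tri≈ _ refl _ = ⊥-elim (not-p≡q sq₁ SQ₁ SQ₁-fits sq₂ SQ₂ SQ₂-fits 0<p p<P q<Q P≢Q last₁ last₂)
  ... | tri> _ _ q<p = ⊥-elim (not-q<p sq₁ SQ₁ SQ₁-fits sq₂ p<P q<p last₁ last₂)

module Words {A : Set} where

  open Periodicity using (HasPeriod; Square)
  open FrontSquares using (NoRecurrence)

  -- 0-based letter access; Defs counts locations from 1
  _‼_ : List A → ℕ → Maybe A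
  []       ‼ _     = nothing
  (x ∷ _)  ‼ zero  = just x
  (_ ∷ xs) ‼ suc i = xs ‼ i

  ‼-++ʳ : ∀ (xs ys : List A) i → (xs ++ ys) ‼ (length xs + i) ≡ ys ‼ i
  ‼-++ʳ []       ys i = refl
  ‼-++ʳ (x ∷ xs) ys i = ‼-++ʳ xs ys i

  ‼-++ˡ : ∀ (xs ys : List A) {i} → i < length xs → (xs ++ ys) ‼ i ≡ xs ‼ i
  ‼-++ˡ (x ∷ xs) ys {zero}  _          = refl
  ‼-++ˡ (x ∷ xs) ys {suc i} (s≤s i<∣xs∣) = ‼-++ˡ xs ys i<∣xs∣

  ‼-drop : ∀ n (xs : List A) i → drop n xs ‼ i ≡ xs ‼ (n + i)
  ‼-drop zero    xs       i = refl
  ‼-drop (suc n) []       i = refl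
  ‼-drop (suc n) (x ∷ xs) i = ‼-drop n xs i

  prefix-by-‼ : ∀ (ys xs : List A) → (∀ i → i < length ys → xs ‼ i ≡ ys ‼ i) → ∃ λ rest → xs ≡ ys ++ rest
  prefix-by-‼ []       xs       _     = xs , refl
  prefix-by-‼ (y ∷ ys) []       agree with agree 0 (s≤s z≤n)
  ... | ()
  prefix-by-‼ (y ∷ ys) (x ∷ xs) agree with agree 0 (s≤s z≤n) | prefix-by-‼ ys xs (λ i → agree (suc i) ∘ s≤s)
  ... | refl | rest , xs≡ys++rest = rest , cong (x ∷_) xs≡ys++rest

  square-periodic : ∀ pre (u rest : List A) → Square ((pre ++ u ++ u ++ rest) ‼_) (length u) (length pre)
  square-periodic pre u rest i ∣pre∣≤i i+∣u∣<… with m≤n⇒∃[o]m+o≡n ∣pre∣≤i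
  ... | j , refl = begin
      w ‼ (length pre + j)            ≡⟨ ‼-++ʳ pre _ j ⟩
      (u ++ u ++ rest) ‼ j            ≡⟨ ‼-++ˡ u _ j<∣u∣ ⟩
      u ‼ j                           ≡⟨ ‼-++ˡ u rest j<∣u∣ ⟨
      (u ++ rest) ‼ j                 ≡⟨ ‼-++ʳ u _ j ⟨
      (u ++ u ++ rest) ‼ (length u + j) ≡⟨ ‼-++ʳ pre _ (length u + j) ⟨
      w ‼ (length pre + (length u + j)) ≡⟨ cong (w ‼_) (x∙yz≈xz∙y (length pre) (length u) j) ⟩
      w ‼ (length pre + j + length u) ∎
    where
    open ≡-Reasoning
    w = pre ++ u ++ u ++ rest
    j<∣u∣ : j < length u
    j<∣u∣ = +-cancelˡ-< (length pre) j (length u)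
              (+-cancelʳ-< (length u) (length pre + j) (length pre + length u) i+∣u∣<…)

  length-square : ∀ pre (u rest : List A) →
                  length (pre ++ u ++ u ++ rest) ≡ length pre + length u + length u + length rest
  length-square pre u rest = begin
      length (pre ++ u ++ u ++ rest)                     ≡⟨ length-++ pre ⟩
      length pre + length (u ++ u ++ rest)               ≡⟨ cong (length pre +_) (length-++ u) ⟩
      length pre + (length u + length (u ++ rest))       ≡⟨ cong ((length pre +_) ∘ (length u +_)) (length-++ u) ⟩
      length pre + (length u + (length u + length rest)) ≡⟨ +-assoc (length pre) (length u) _ ⟨
      length pre + length u + (length u + length rest)   ≡⟨ +-assoc (length pre + length u) (length u) _ ⟨
      length pre + length u + length u + length rest     ∎
    where open ≡-Reasoning

  recurrence⇒square-at : ∀ pre (u rest : List A) h → u ≢ [] → let w = pre ++ u ++ u ++ rest in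
    HasPeriod (w ‼_) h (length pre) (length pre + length u + length u + h) →
    length pre + length u + length u + h ≤ length w → SquareAt w (suc (length pre + h)) u
  recurrence⇒square-at pre u rest h u≢[] per fits =
    u≢[] , take n w , proj₁ suffix , cong suc length-prefix ,
    trans (sym (take++drop≡id n w)) (cong (take n w ++_) (trans (proj₂ suffix) (++-assoc u u _)))
    where
    w = pre ++ u ++ u ++ rest
    n = length pre + h
    n≤∣w∣ : n ≤ length w
    n≤∣w∣ = ≤-trans (+-monoˡ-≤ h (≤-trans (m≤m+n (length pre) _) (m≤m+n _ (length u)))) fits
    length-prefix : length (take n w) ≡ n
    length-prefix = trans (length-take n w) (m≤n⇒m⊓n≡m n≤∣w∣)
    agree : ∀ i → i < length (u ++ u) → drop n w ‼ i ≡ (u ++ u) ‼ i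
    agree i i<∣uu∣ = begin
        drop n w ‼ i                ≡⟨ ‼-drop n w i ⟩
        w ‼ (length pre + h + i)    ≡⟨ cong (w ‼_) (xy∙z≈xz∙y (length pre) h i) ⟩
        w ‼ (length pre + i + h)    ≡⟨ per (length pre + i) (m≤m+n (length pre) i) i+h<… ⟨
        w ‼ (length pre + i)        ≡⟨ ‼-++ʳ pre _ i ⟩
        (u ++ u ++ rest) ‼ i        ≡⟨ cong (_‼ i) (++-assoc u u rest) ⟨
        ((u ++ u) ++ rest) ‼ i      ≡⟨ ‼-++ˡ (u ++ u) rest i<∣uu∣ ⟩
        (u ++ u) ‼ i                ∎
      where
      open ≡-Reasoning
      i+h<… : length pre + i + h < length pre + length u + length u + h
      i+h<… = +-monoˡ-< h (subst (length pre + i <_) (sym (+-assoc (length pre) (length u) (length u)))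
                (+-monoʳ-< (length pre) (subst (i <_) (length-++ u) i<∣uu∣)))
    suffix : ∃ λ rest′ → drop n w ≡ (u ++ u) ++ rest′
    suffix = prefix-by-‼ (u ++ u) (drop n w) agree

  nonempty⇒0<length : ∀ {u : List A} → u ≢ [] → 0 < length u
  nonempty⇒0<length {[]}    u≢[] = ⊥-elim (u≢[] refl)
  nonempty⇒0<length {_ ∷ _} _    = s≤s z≤n

  square-at⇒square : ∀ {w a} {u : List A} → SquareAt w (suc a) u → Square (w ‼_) (length u) a
  square-at⇒square {u = u} (_ , pre , rest , refl , refl) = square-periodic pre u rest

  square-at-fits : ∀ {w a} {u : List A} → SquareAt w (suc a) u → a + length u + length u ≤ length w
  square-at-fits {u = u} (_ , pre , rest , refl , refl) =
    ≤-slack (length rest) (sym (length-square pre u rest))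

  last⇒no-recurrence : ∀ {w a} {u : List A} → LastSquareAt w (suc a) u →
                       NoRecurrence (w ‼_) (length u) a (length w)
  last⇒no-recurrence {u = u} ((u≢[] , pre , rest , refl , refl) , last) h 0<h fits per =
    last (suc (length pre + h)) (s≤s (m<m+n (length pre) 0<h))
         (recurrence⇒square-at pre u rest h u≢[] per fits)

open FrontSquares using (two-front-squares)
open Words

lemma9 : {A : Set} (w : List A) →
    sIs w 1 2 → sIs w 2 2 →
    (sq₁ SQ₁ sq₂ SQ₂ : List A) →
    LastSquareAt w 1 sq₁ → LastSquareAt w 1 SQ₁ → length sq₁ < length SQ₁ →
    LastSquareAt w 2 sq₂ → LastSquareAt w 2 SQ₂ → length sq₂ < length SQ₂ →
    length SQ₁ ≢ length SQ₂ →
    length sq₁ < length sq₂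
lemma9 w _ _ sq₁ SQ₁ sq₂ SQ₂ last₁ (SQ₁-at , _) p<P last₂ (SQ₂-at , _) q<Q P≢Q =
  two-front-squares (w ‼_)
    (square-at⇒square (proj₁ last₁)) (square-at⇒square SQ₁-at) (square-at-fits SQ₁-at)
    (square-at⇒square (proj₁ last₂)) (square-at⇒square SQ₂-at) (square-at-fits SQ₂-at)
    (nonempty⇒0<length (proj₁ (proj₁ last₁))) p<P q<Q P≢Q
    (last⇒no-recurrence last₁) (last⇒no-recurrence last₂)
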